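{- For a graph $G$, let $\equiv_G$ be the relation on $V(G)$ given by $x\equiv_G y$ iff $\rho_G(\{x\})=\rho_G(\{y\})\ge\rho_G(\{x,y\})$. Then $\equiv_G$ is an equivalence relation on $V(G)$, and each equivalence class of $(V(G),\equiv_G)$ is one of the following in $G$: the vertex set of an attached star, a clique of true twins, or an independent set of false twins.
   Context: Graphs are finite and simple. $\rho_G(X)$ is the rank over the binary field of the $X\times(V(G)\setminus X)$ matrix with $(i,j)$-entry $1$ iff $i,j$ adjacent. Two distinct vertices $x,y$ are twins if $N(x)\setminus\{x,y\}=N(y)\setminus\{x,y\}$; true twins if additionally adjacent, false twins otherwise. An attached star in $G$ is an induced subgraph $G[S]$ isomorphic to a star (some $K_{1,k}$, $k\ge0$, with a designated central vertex) whose noncentral vertices have no neighbors in $V(G)\setminus S$. -}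

module Defs where

open import Data.Nat using (ℕ; zero; suc; _⊔_; _≤_)
open import Data.Bool using (Bool; true; false; _∧_; _∨_; not; _xor_)
open import Data.Fin using (Fin)
open import Data.Fin.Subset using (Subset; ⁅_⁆; _∪_; ∣_∣)
open import Data.Vec using (Vec; []; _∷_; lookup)
open import Data.List using (List; []; _∷_; map; filter; foldr; allFin; _++_)
open import Data.Bool.ListAction using (all; any)
open import Data.Product using (Σ; _×_)
open import Relation.Binary.PropositionalEquality using (_≡_; _≢_)
open import Relation.Nullary using (¬_)
open import Data.Bool.Properties using (T?)

record Graph (n : ℕ) : Set where
  field
    adj    : Fin n → Fin n → Bool
    sym    : ∀ x y → adj x y ≡ adj y x
    irrefl : ∀ x → adj x x ≡ false
open Graph public

module _ {n : ℕ} (G : Graph n) where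
  Adj : Fin n → Fin n → Set
  Adj x y = adj G x y ≡ true

subsets : (n : ℕ) → List (Subset n)
subsets zero = [] ∷ []
subsets (suc n) = map (false ∷_) (subsets n) ++ map (true ∷_) (subsets n)

allᵇ : {n : ℕ} → (Fin n → Bool) → Bool
allᵇ {n} p = all p (allFin n)

_⊆ᵇ_ : {n : ℕ} → Subset n → Subset n → Bool
S ⊆ᵇ X = allᵇ (λ i → not (lookup S i) ∨ lookup X i)

nonemptyᵇ : {n : ℕ} → Subset n → Bool
nonemptyᵇ {n} S = any (lookup S) (allFin n)

module _ {n : ℕ} (G : Graph n) where
  -- row of x in the X × (V \ X) adjacency matrix over GF(2),
  -- indexed by all vertices with zero entries in the columns of X.
  row : Subset n → Fin n → Fin n → Bool
  row X x y = adj G x y ∧ not (lookup X y)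

  sumRows : Subset n → Subset n → Fin n → Bool
  sumRows X T y = foldr _xor_ false (map (λ i → lookup T i ∧ row X i y) (allFin n))

  -- the rows of X indexed by S are linearly independent over GF(2):
  -- no nonempty subfamily sums to zero
  indepᵇ : Subset n → Subset n → Bool
  indepᵇ X S = all (λ Tt → not (Tt ⊆ᵇ S ∧ nonemptyᵇ Tt)
                              ∨ not (allᵇ (λ y → not (sumRows X Tt y))))
                     (subsets n)

  -- cut-rank ρ_G(X): rank over GF(2) of the X × (V\X) adjacency matrix,
  -- i.e. the maximum number of linearly independent rows.
  ρ : Subset n → ℕ
  ρ X = foldr _⊔_ 0 (map ∣_∣ (filter (λ S → T? (S ⊆ᵇ X ∧ indepᵇ X S)) (subsets n)))

  _≡G_ : Fin n → Fin n → Set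
  x ≡G y = (ρ ⁅ x ⁆ ≡ ρ ⁅ y ⁆) × (ρ (⁅ x ⁆ ∪ ⁅ y ⁆) ≤ ρ ⁅ x ⁆)

  Twins : Fin n → Fin n → Set
  Twins x y = x ≢ y × (∀ z → z ≢ x → z ≢ y → adj G x z ≡ adj G y z)

  -- C (a vertex set given as a predicate) is the vertex set of an attached star
  -- G[C] ≅ K_{1,k} with centre c, noncentral vertices have no neighbours outside C
  IsAttachedStar : (Fin n → Set) → Set
  IsAttachedStar C = Σ (Fin n) λ c → C c
    × (∀ v → C v → v ≢ c → Adj G c v)
    × (∀ u v → C u → C v → u ≢ c → v ≢ c → ¬ Adj G u v)
    × (∀ u w → C u → u ≢ c → ¬ C w → ¬ Adj G u w)

  IsTrueTwinClique : (Fin n → Set) → Set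
  IsTrueTwinClique C = ∀ u v → C u → C v → u ≢ v → Adj G u v × Twins u v

  IsFalseTwinIndep : (Fin n → Set) → Set
  IsFalseTwinIndep C = ∀ u v → C u → C v → u ≢ v → ¬ Adj G u v × Twins u v

module Submission where

-- The cut-rank of a single vertex is 0 or 1 according as it is isolated or not.  For x ≠ y, the
-- rows of x and y in the cut ({x,y}, V ∖ {x,y}) are dependent over GF(2) exactly when one of them
-- vanishes (N(x) ⊆ {y} or N(y) ⊆ {x}) or they agree (x and y are twins).  Hence x ≡G y iff x and
-- y are both isolated, or both have a neighbour and are related in one of these three ways, and a
-- case analysis of the three relations shows that this is transitive.  In a class of
-- non-isolated vertices, one member whose only neighbour is another member v forces every member
-- other than v to be a leaf at v: an attached star.  Otherwise all members are pairwise twins, and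
-- adjacency between distinct members is constant: true twins forming a clique, or false twins
-- forming an independent set.

open import Defs
open import Data.Nat using (ℕ)
open import Data.Fin using (Fin)
open import Data.Product using (_×_)
open import Data.Sum using (_⊎_)
open import Relation.Binary.Structures using (IsEquivalence)

open import Algebra.Bundles using (CommutativeMonoid; CommutativeRing)
open import Data.Bool using (Bool; true; false; not; _∧_; _∨_; _xor_; T)
open import Data.Bool.Properties
  using (T?; T-≡; T-∧; ¬-not; xor-same; xor-identityʳ; xor-inverseˡ; ∧-zeroʳ; ∧-identityʳ; xor-∧-commutativeRing)
  renaming (_≟_ to _≟ᵇ_)
open import Data.Fin using (zero; suc; _≟_; punchIn; punchOut)
open import Data.Fin.Properties using (punchInᵢ≢i; punchIn-injective; punchIn-punchOut; ¬∀⟶∃¬; all?; any?)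
open import Data.Fin.Subset using (Subset; _∈_; _∉_; _⊆_; Nonempty; ⁅_⁆; _∪_; ∣_∣)
open import Data.Fin.Subset.Properties
  using (x∈⁅x⁆; x∈⁅y⁆⇒x≡y; x≢y⇒x∉⁅y⁆; x∈p∪q⁺; x∈p∪q⁻; _∈?_; ∪-idem; ∪-comm;
         Empty-unique; ∣⊥∣≡0; ∣⁅x⁆∣≡1; p⊆q⇒∣p∣≤∣q∣; x∈p⇒∣p-x∣<∣p∣; x∈p∧x≢y⇒x∈p-y)
open import Data.List using (map; foldr; filter; allFin; tabulate)
import Data.List.Membership.Propositional as List
open import Data.List.Membership.Propositional using (lose)
open import Data.List.Membership.Propositional.Properties using (∈-allFin; ∈-++⁺ˡ; ∈-++⁺ʳ; ∈-map⁺; ∈-filter⁺)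
open import Data.List.Properties using (map-tabulate; foldr-preservesᵇ; foldr-preservesᵒ)
import Data.List.Relation.Unary.All as All
open import Data.List.Relation.Unary.All.Properties using (all⁺; all⁻; all-filter)
import Data.List.Relation.Unary.All.Properties as Allₚ
open import Data.List.Relation.Unary.Any using (here; satisfied)
open import Data.List.Relation.Unary.Any.Properties using (any⁺; any⁻)
import Data.List.Relation.Unary.Any.Properties as Anyₚ
open import Data.Nat using (_≤_; z≤n; s≤s)
open import Data.Nat.Properties using (≤-refl; ≤-trans; ≤-antisym; ≤-reflexive; ⊔-lub; m≤n⇒m≤n⊔o; m≤n⇒m≤o⊔n; n≤0⇒n≡0)
open import Data.Product using (∃; _,_; proj₁; proj₂)
open import Data.Sum as Sum using (inj₁; inj₂; [_,_]; [_,_]′)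
open import Data.Vec using ([]; _∷_; lookup)
open import Data.Vec.Properties using ([]=⇒lookup; lookup⇒[]=)
import Data.Vec.Functional as Vector
open import Function using (_∘_; Equivalence)
open import Level using (0ℓ)
open import Relation.Binary.PropositionalEquality as ≡ using (_≡_; _≢_; refl; trans; cong; subst; ≢-sym)
open import Relation.Nullary using (¬_; Dec; yes; no; contradiction)
open import Relation.Nullary.Decidable using (¬?; _→-dec_; _×-dec_; _⊎-dec_)
open import Relation.Unary using (Decidable)

module SupportedSum {c ℓ} (M : CommutativeMonoid c ℓ) where

  open CommutativeMonoid M using (Carrier; _≈_; setoid; identityʳ)
    renaming (_∙_ to _+_; ε to 0#; ∙-congˡ to +-congˡ; trans to ≈-trans)
  open import Algebra.Properties.CommutativeMonoid.Sum M using (sum; sum-cong-≋; sum-replicate-zero; sum-remove)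
  open import Relation.Binary.Reasoning.Setoid setoid

  sum-zero : ∀ {n} (t : Vector.Vector Carrier n) → (∀ i → t i ≈ 0#) → sum t ≈ 0#
  sum-zero {n} t t≈0 = ≈-trans (sum-cong-≋ t≈0) (sum-replicate-zero n)

  sum-single : ∀ {n} (t : Vector.Vector Carrier n) i → (∀ j → j ≢ i → t j ≈ 0#) → sum t ≈ t i
  sum-single {ℕ.suc n} t i off = begin
    sum t                           ≈⟨ sum-remove t ⟩
    t i + sum (Vector.removeAt t i) ≈⟨ +-congˡ (sum-zero _ (λ j → off _ (punchInᵢ≢i i j))) ⟩
    t i + 0#                        ≈⟨ identityʳ (t i) ⟩
    t i                             ∎

  sum-pair : ∀ {n} (t : Vector.Vector Carrier n) {i j} → i ≢ j
           → (∀ k → k ≢ i → k ≢ j → t k ≈ 0#) → sum t ≈ t i + t j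
  sum-pair {ℕ.suc n} t {i} {j} i≢j off = begin
    sum t                           ≈⟨ sum-remove t ⟩
    t i + sum (Vector.removeAt t i) ≈⟨ +-congˡ (sum-single _ (punchOut i≢j) off′) ⟩
    t i + t (punchIn i (punchOut i≢j)) ≡⟨ ≡.cong (λ k → t i + t k) (punchIn-punchOut i≢j) ⟩
    t i + t j                       ∎
    where
    off′ : ∀ k → k ≢ punchOut i≢j → t (punchIn i k) ≈ 0#
    off′ k k≢j′ = off _ (punchInᵢ≢i i k)
      (λ ik≡j → k≢j′ (punchIn-injective i _ _ (≡.trans ik≡j (≡.sym (punchIn-punchOut i≢j)))))

⊕-commutativeMonoid : CommutativeMonoid 0ℓ 0ℓ
⊕-commutativeMonoid = CommutativeRing.+-commutativeMonoid xor-∧-commutativeRing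

open SupportedSum ⊕-commutativeMonoid using (sum-single; sum-pair)
open import Algebra.Properties.CommutativeMonoid.Sum ⊕-commutativeMonoid using (sum)
open Equivalence using (to; from)

foldr-tabulate : ∀ {A B : Set} (f : A → B → B) e {n} (g : Fin n → A)
               → foldr f e (tabulate g) ≡ Vector.foldr f e g
foldr-tabulate f e {ℕ.zero}  g = refl
foldr-tabulate f e {ℕ.suc n} g = cong (f (g zero)) (foldr-tabulate f e (g ∘ suc))

foldr-map-allFin : ∀ {A B : Set} (f : A → B → B) e {n} (g : Fin n → A)
                 → foldr f e (map g (allFin n)) ≡ Vector.foldr f e g
foldr-map-allFin f e g = trans (cong (foldr f e) (map-tabulate (λ i → i) g)) (foldr-tabulate f e g)

∈-subsets : ∀ {n} (S : Subset n) → S List.∈ subsets n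
∈-subsets []                    = here refl
∈-subsets (false ∷ S)           = ∈-++⁺ˡ (∈-map⁺ (false ∷_) (∈-subsets S))
∈-subsets {ℕ.suc n} (true ∷ S) = ∈-++⁺ʳ (map (false ∷_) (subsets n)) (∈-map⁺ (true ∷_) (∈-subsets S))

module _ {n : ℕ} where

  ∈⇒T : ∀ {S : Subset n} {i} → i ∈ S → T (lookup S i)
  ∈⇒T i∈S = from T-≡ ([]=⇒lookup i∈S)

  T⇒∈ : ∀ {S : Subset n} {i} → T (lookup S i) → i ∈ S
  T⇒∈ t = lookup⇒[]= _ _ (to T-≡ t)

  ∉⇒lookup≡false : ∀ {S : Subset n} {i} → i ∉ S → lookup S i ≡ false
  ∉⇒lookup≡false i∉S = ¬-not (i∉S ∘ lookup⇒[]= _ _)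

  allᵇ⁺ : ∀ {p : Fin n → Bool} → T (allᵇ p) → ∀ i → T (p i)
  allᵇ⁺ {p} h i = All.lookup (all⁺ p (allFin n) h) (∈-allFin i)

  allᵇ⁻ : ∀ {p : Fin n → Bool} → (∀ i → T (p i)) → T (allᵇ p)
  allᵇ⁻ {p} h = all⁻ p {allFin n} (All.tabulate (λ {i} _ → h i))

  ⊆ᵇ⁺ : ∀ {S X : Subset n} → T (S ⊆ᵇ X) → S ⊆ X
  ⊆ᵇ⁺ {S} h {i} i∈S = T⇒∈ (implication (lookup S i) (allᵇ⁺ h i) (∈⇒T i∈S))
    where
    implication : ∀ a {b} → T (not a ∨ b) → T a → T b
    implication true  b _ = b

  ⊆ᵇ⁻ : ∀ {S X : Subset n} → S ⊆ X → T (S ⊆ᵇ X)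
  ⊆ᵇ⁻ {S} S⊆X = allᵇ⁻ (λ i → implication (lookup S i) (λ t → ∈⇒T (S⊆X (T⇒∈ t))))
    where
    implication : ∀ a {b} → (T a → T b) → T (not a ∨ b)
    implication true  f = f _
    implication false _ = _

  nonemptyᵇ⁺ : ∀ {S : Subset n} → T (nonemptyᵇ S) → Nonempty S
  nonemptyᵇ⁺ {S} h with satisfied (any⁻ (lookup S) (allFin n) h)
  ... | i , t = i , T⇒∈ t

  nonemptyᵇ⁻ : ∀ {S : Subset n} → Nonempty S → T (nonemptyᵇ S)
  nonemptyᵇ⁻ {S} (i , i∈S) = any⁺ (lookup S) (lose (∈-allFin i) (∈⇒T i∈S))

module _ {n : ℕ} {x : Fin n} where

  ⁅⁆⊆ : ∀ {S : Subset n} → x ∈ S → ⁅ x ⁆ ⊆ S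
  ⁅⁆⊆ {S} x∈S i∈⁅x⁆ = subst (_∈ S) (≡.sym (x∈⁅y⁆⇒x≡y x i∈⁅x⁆)) x∈S

  ∣S∣≤1 : ∀ {S : Subset n} → S ⊆ ⁅ x ⁆ → ∣ S ∣ ≤ 1
  ∣S∣≤1 S⊆⁅x⁆ = subst (_ ≤_) (∣⁅x⁆∣≡1 x) (p⊆q⇒∣p∣≤∣q∣ S⊆⁅x⁆)

  1≤∣S∣ : ∀ {S : Subset n} → x ∈ S → 1 ≤ ∣ S ∣
  1≤∣S∣ x∈S = subst (_≤ _) (∣⁅x⁆∣≡1 x) (p⊆q⇒∣p∣≤∣q∣ (⁅⁆⊆ x∈S))

module _ {n : ℕ} {x y : Fin n} where

  x∈⁅x⁆∪⁅y⁆ : x ∈ ⁅ x ⁆ ∪ ⁅ y ⁆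
  x∈⁅x⁆∪⁅y⁆ = x∈p∪q⁺ (inj₁ (x∈⁅x⁆ x))

  y∈⁅x⁆∪⁅y⁆ : y ∈ ⁅ x ⁆ ∪ ⁅ y ⁆
  y∈⁅x⁆∪⁅y⁆ = x∈p∪q⁺ (inj₂ (x∈⁅x⁆ y))

  ∈⁅⁆∪⁅⁆⁻ : ∀ {i} → i ∈ ⁅ x ⁆ ∪ ⁅ y ⁆ → i ≡ x ⊎ i ≡ y
  ∈⁅⁆∪⁅⁆⁻ i∈ = Sum.map (x∈⁅y⁆⇒x≡y x) (x∈⁅y⁆⇒x≡y y) (x∈p∪q⁻ ⁅ x ⁆ ⁅ y ⁆ i∈)

  ⊆⁅⁆∪⁅⁆-∉ˡ : ∀ {S : Subset n} → S ⊆ ⁅ x ⁆ ∪ ⁅ y ⁆ → x ∉ S → S ⊆ ⁅ y ⁆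
  ⊆⁅⁆∪⁅⁆-∉ˡ {S} S⊆ x∉S {i} i∈S =
    [ (λ i≡x → contradiction (subst (_∈ S) i≡x i∈S) x∉S) , (λ i≡y → subst (_∈ ⁅ y ⁆) (≡.sym i≡y) (x∈⁅x⁆ y)) ]
      (∈⁅⁆∪⁅⁆⁻ (S⊆ i∈S))

  ⁅⁆∪⁅⁆⊆ : ∀ {S : Subset n} → x ∈ S → y ∈ S → ⁅ x ⁆ ∪ ⁅ y ⁆ ⊆ S
  ⁅⁆∪⁅⁆⊆ {S} x∈S y∈S i∈ =
    [ (λ i≡x → subst (_∈ S) (≡.sym i≡x) x∈S) , (λ i≡y → subst (_∈ S) (≡.sym i≡y) y∈S) ] (∈⁅⁆∪⁅⁆⁻ i∈)

  2≤∣⁅x⁆∪⁅y⁆∣ : x ≢ y → 2 ≤ ∣ ⁅ x ⁆ ∪ ⁅ y ⁆ ∣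
  2≤∣⁅x⁆∪⁅y⁆∣ x≢y = ≤-trans (s≤s (1≤∣S∣ (x∈p∧x≢y⇒x∈p-y y∈⁅x⁆∪⁅y⁆ (≢-sym x≢y)))) (x∈p⇒∣p-x∣<∣p∣ x∈⁅x⁆∪⁅y⁆)

⊆⁅⁆∪⁅⁆-∉ʳ : ∀ {n} {x y : Fin n} {S : Subset n} → S ⊆ ⁅ x ⁆ ∪ ⁅ y ⁆ → y ∉ S → S ⊆ ⁅ x ⁆
⊆⁅⁆∪⁅⁆-∉ʳ {x = x} {y} S⊆ = ⊆⁅⁆∪⁅⁆-∉ˡ (subst (_ ∈_) (∪-comm ⁅ x ⁆ ⁅ y ⁆) ∘ S⊆)

¬∀-off⇒∃ : ∀ {n} {x y : Fin n} {P : Fin n → Set} → Decidable P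
         → ¬ (∀ t → t ≢ x → t ≢ y → P t) → ∃ λ t → t ≢ x × t ≢ y × ¬ P t
¬∀-off⇒∃ {n} {x} {y} P? ¬∀ with ¬∀⟶∃¬ n _ (λ t → ¬? (t ≟ x) →-dec ¬? (t ≟ y) →-dec P? t) ¬∀
... | t , ¬Pt = t , (λ t≡x → ¬Pt λ t≢x → contradiction t≡x t≢x)
                  , (λ t≡y → ¬Pt λ _ t≢y → contradiction t≡y t≢y)
                  , (λ Pt → ¬Pt λ _ _ → Pt)

module Rank {n : ℕ} (G : Graph n) where

  open ≡.≡-Reasoning

  NonZero : (Fin n → Bool) → Set
  NonZero r = ∃ λ t → r t ≡ true

  Independent : Subset n → Subset n → Set
  Independent X S = ∀ R → R ⊆ S → Nonempty R → NonZero (sumRows G X R)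

  -- Over GF(2), r and s are linearly independent iff r, s and r xor s are all nonzero.
  IndependentRows : (Fin n → Bool) → (Fin n → Bool) → Set
  IndependentRows r s = NonZero r × NonZero s × NonZero (λ t → r t xor s t)

  DependentRows : (Fin n → Bool) → (Fin n → Bool) → Set
  DependentRows r s = (∀ t → r t ≡ false) ⊎ (∀ t → s t ≡ false) ⊎ (∀ t → r t ≡ s t)

  T-clause⁺ : ∀ {a b c} → T (not (a ∧ b) ∨ not c) → T a → T b → ¬ T c
  T-clause⁺ {true} {true} {true} ()

  T-clause⁻ : ∀ {a b c} → (T a → T b → ¬ T c) → T (not (a ∧ b) ∨ not c)
  T-clause⁻ {true}  {true}  {true}  f = f _ _ _
  T-clause⁻ {true}  {true}  {false} _ = _
  T-clause⁻ {true}  {false}         _ = _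
  T-clause⁻ {false}                 _ = _

  indepᵇ⁺ : ∀ {X S} → T (indepᵇ G X S) → Independent X S
  indepᵇ⁺ {X} {S} h R R⊆S ne = witness (¬∀⟶∃¬ n _ (λ t → T? (not (sumRows G X R t))) ¬allZero)
    where
    ¬allZero : ¬ (∀ t → T (not (sumRows G X R t)))
    ¬allZero = T-clause⁺ (All.lookup (all⁺ _ (subsets n) h) (∈-subsets R)) (⊆ᵇ⁻ R⊆S) (nonemptyᵇ⁻ ne) ∘ allᵇ⁻
    witness : (∃ λ t → ¬ T (not (sumRows G X R t))) → NonZero (sumRows G X R)
    witness (t , ¬T) = t , ¬-not (¬T ∘ from T-≡ ∘ cong not)

  indepᵇ⁻ : ∀ {X S} → Independent X S → T (indepᵇ G X S)
  indepᵇ⁻ {X} {S} ind = all⁻ _ {subsets n} (All.tabulate (λ {R} _ → T-clause⁻ (noZeroSum R)))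
    where
    noZeroSum : ∀ R → T (R ⊆ᵇ S) → T (nonemptyᵇ R) → ¬ T (allᵇ (λ t → not (sumRows G X R t)))
    noZeroSum R R⊆S ne allZero with ind R (⊆ᵇ⁺ R⊆S) (nonemptyᵇ⁺ ne)
    ... | t , sum≡true = subst (T ∘ not) sum≡true (allᵇ⁺ allZero t)

  ρ-≤ : ∀ {X k} → (∀ S → S ⊆ X → Independent X S → ∣ S ∣ ≤ k) → ρ G X ≤ k
  ρ-≤ {X} {k} bound = foldr-preservesᵇ {P = _≤ k} ⊔-lub z≤n
    (Allₚ.map⁺ {f = ∣_∣} (All.map (λ {S} → boundT S) (all-filter (λ S → T? (S ⊆ᵇ X ∧ indepᵇ G X S)) (subsets n))))
    where
    boundT : ∀ S → T (S ⊆ᵇ X ∧ indepᵇ G X S) → ∣ S ∣ ≤ k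
    boundT S t = bound S (⊆ᵇ⁺ {S = S} {X = X} (proj₁ (to T-∧ t))) (indepᵇ⁺ {X} {S} (proj₂ (to T-∧ t)))

  ≤-ρ : ∀ {X S} → S ⊆ X → Independent X S → ∣ S ∣ ≤ ρ G X
  ≤-ρ {X} {S} S⊆X ind = foldr-preservesᵒ {P = ∣ S ∣ ≤_} (λ a b → [ m≤n⇒m≤n⊔o b , m≤n⇒m≤o⊔n a ]) 0 _
    (inj₂ (Anyₚ.map⁺ (lose S∈candidates ≤-refl)))
    where
    S∈candidates : S List.∈ filter (λ S → T? (S ⊆ᵇ X ∧ indepᵇ G X S)) (subsets n)
    S∈candidates = ∈-filter⁺ (λ S → T? (S ⊆ᵇ X ∧ indepᵇ G X S)) (∈-subsets S)
                             (from T-∧ (⊆ᵇ⁻ {S = S} {X = X} S⊆X , indepᵇ⁻ {X} {S} ind))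

  sumRows≡sum : ∀ X R t → sumRows G X R t ≡ sum (λ i → lookup R i ∧ row G X i t)
  sumRows≡sum X R t = foldr-map-allFin _xor_ false (λ i → lookup R i ∧ row G X i t)

  sumRows-⊆⁅⁆ : ∀ {X R x} → R ⊆ ⁅ x ⁆ → ∀ t → sumRows G X R t ≡ lookup R x ∧ row G X x t
  sumRows-⊆⁅⁆ {X} {R} {x} R⊆ t = trans (sumRows≡sum X R t) (sum-single _ x off)
    where
    off : ∀ i → i ≢ x → lookup R i ∧ row G X i t ≡ false
    off i i≢x = cong (_∧ row G X i t) (∉⇒lookup≡false (i≢x ∘ x∈⁅y⁆⇒x≡y x ∘ R⊆))

  sumRows-⊆⁅⁆∪⁅⁆ : ∀ {X R x y} → x ≢ y → R ⊆ ⁅ x ⁆ ∪ ⁅ y ⁆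
               → ∀ t → sumRows G X R t ≡ (lookup R x ∧ row G X x t) xor (lookup R y ∧ row G X y t)
  sumRows-⊆⁅⁆∪⁅⁆ {X} {R} {x} {y} x≢y R⊆ t = trans (sumRows≡sum X R t) (sum-pair _ x≢y off)
    where
    off : ∀ i → i ≢ x → i ≢ y → lookup R i ∧ row G X i t ≡ false
    off i i≢x i≢y = cong (_∧ row G X i t) (∉⇒lookup≡false ([ i≢x , i≢y ] ∘ ∈⁅⁆∪⁅⁆⁻ ∘ R⊆))

  Independent-⊆ : ∀ {X S R} → R ⊆ S → Independent X S → Independent X R
  Independent-⊆ R⊆S ind Q Q⊆R = ind Q (R⊆S ∘ Q⊆R)

  independent⇒nonZero : ∀ {X S x} → Independent X S → x ∈ S → NonZero (row G X x)
  independent⇒nonZero {X} {S} {x} ind x∈S with ind ⁅ x ⁆ (⁅⁆⊆ x∈S) (x , x∈⁅x⁆ x)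
  ... | t , sum≡true = t , (begin
    row G X x t                         ≡⟨ cong (_∧ row G X x t) ([]=⇒lookup (x∈⁅x⁆ x)) ⟨
    lookup ⁅ x ⁆ x ∧ row G X x t        ≡⟨ sumRows-⊆⁅⁆ {X = X} {x = x} (λ i∈ → i∈) t ⟨
    sumRows G X ⁅ x ⁆ t                 ≡⟨ sum≡true ⟩
    true                                ∎)

  ρ≡0 : ∀ {X} → (∀ {i} → i ∈ X → ∀ t → row G X i t ≡ false) → ρ G X ≡ 0
  ρ≡0 {X} zeroRows =
    n≤0⇒n≡0 (ρ-≤ {X} λ S S⊆X ind → ≤-reflexive (trans (cong ∣_∣ (Empty-unique (empty S⊆X ind))) (∣⊥∣≡0 n)))
    where
    empty : ∀ {S} → S ⊆ X → Independent X S → ¬ Nonempty S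
    empty S⊆X ind (i , i∈S) with independent⇒nonZero {X} ind i∈S
    ... | t , e = contradiction (trans (≡.sym e) (zeroRows (S⊆X i∈S) t)) λ ()

  ρ≤∣X∣ : ∀ X → ρ G X ≤ ∣ X ∣
  ρ≤∣X∣ X = ρ-≤ {X} (λ S S⊆X _ → p⊆q⇒∣p∣≤∣q∣ S⊆X)

  nonZero⇒1≤ρ : ∀ {X x} → x ∈ X → NonZero (row G X x) → 1 ≤ ρ G X
  nonZero⇒1≤ρ {X} {x} x∈X (t , e) = subst (_≤ ρ G X) (∣⁅x⁆∣≡1 x) (≤-ρ {X} (⁅⁆⊆ x∈X) independent)
    where
    independent : Independent X ⁅ x ⁆
    independent R R⊆⁅x⁆ (i , i∈R) = t , (begin
      sumRows G X R t             ≡⟨ sumRows-⊆⁅⁆ {X = X} R⊆⁅x⁆ t ⟩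
      lookup R x ∧ row G X x t    ≡⟨ cong (_∧ row G X x t) ([]=⇒lookup x∈R) ⟩
      row G X x t                 ≡⟨ e ⟩
      true                        ∎)
      where
      x∈R : x ∈ R
      x∈R = subst (_∈ R) (x∈⁅y⁆⇒x≡y x (R⊆⁅x⁆ i∈R)) i∈R

  dependent⇒¬independent : ∀ {r s} → DependentRows r s → ¬ IndependentRows r s
  dependent⇒¬independent (inj₁ r≡0)        ((t , e) , _)         = contradiction (trans (≡.sym e) (r≡0 t)) λ ()
  dependent⇒¬independent (inj₂ (inj₁ s≡0)) (_ , (t , e) , _)     = contradiction (trans (≡.sym e) (s≡0 t)) λ ()
  dependent⇒¬independent {r} {s} (inj₂ (inj₂ r≡s)) (_ , _ , (t , e)) =
    contradiction (trans (≡.sym e) (trans (cong (_xor s t) (r≡s t)) (xor-same (s t)))) λ ()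

  module _ {X : Subset n} {x y : Fin n} (x≢y : x ≢ y) where

    x∈P : x ∈ ⁅ x ⁆ ∪ ⁅ y ⁆
    x∈P = x∈⁅x⁆∪⁅y⁆

    y∈P : y ∈ ⁅ x ⁆ ∪ ⁅ y ⁆
    y∈P = y∈⁅x⁆∪⁅y⁆

    independent-⁅⁆∪⁅⁆⁺ : Independent X (⁅ x ⁆ ∪ ⁅ y ⁆) → IndependentRows (row G X x) (row G X y)
    independent-⁅⁆∪⁅⁆⁺ ind with ind (⁅ x ⁆ ∪ ⁅ y ⁆) (λ i∈ → i∈) (x , x∈P)
    ... | t , e = independent⇒nonZero {X} ind x∈P , independent⇒nonZero {X} ind y∈P , t , (begin
      row G X x t xor row G X y t
        ≡⟨ ≡.cong₂ (λ a b → (a ∧ row G X x t) xor (b ∧ row G X y t)) ([]=⇒lookup x∈P) ([]=⇒lookup y∈P) ⟨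
      (lookup (⁅ x ⁆ ∪ ⁅ y ⁆) x ∧ row G X x t) xor (lookup (⁅ x ⁆ ∪ ⁅ y ⁆) y ∧ row G X y t)
        ≡⟨ sumRows-⊆⁅⁆∪⁅⁆ {X = X} x≢y (λ i∈ → i∈) t ⟨
      sumRows G X (⁅ x ⁆ ∪ ⁅ y ⁆) t
        ≡⟨ e ⟩
      true ∎)

    independent-⁅⁆∪⁅⁆⁻ : IndependentRows (row G X x) (row G X y) → Independent X (⁅ x ⁆ ∪ ⁅ y ⁆)
    independent-⁅⁆∪⁅⁆⁻ ((t₁ , e₁) , (t₂ , e₂) , (t₃ , e₃)) R R⊆ (i , i∈R) = nonZero (x ∈? R) (y ∈? R)
      where
      value : ∀ t {a b} → lookup R x ≡ a → lookup R y ≡ b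
            → sumRows G X R t ≡ (a ∧ row G X x t) xor (b ∧ row G X y t)
      value t refl refl = sumRows-⊆⁅⁆∪⁅⁆ {X = X} x≢y R⊆ t
      nonZero : Dec (x ∈ R) → Dec (y ∈ R) → NonZero (sumRows G X R)
      nonZero (yes x∈R) (yes y∈R) = t₃ , trans (value t₃ ([]=⇒lookup x∈R) ([]=⇒lookup y∈R)) e₃
      nonZero (yes x∈R) (no y∉R)  =
        t₁ , trans (value t₁ ([]=⇒lookup x∈R) (∉⇒lookup≡false y∉R)) (trans (xor-identityʳ _) e₁)
      nonZero (no x∉R)  (yes y∈R) = t₂ , trans (value t₂ (∉⇒lookup≡false x∉R) ([]=⇒lookup y∈R)) e₂
      nonZero (no x∉R)  (no y∉R)  =
        contradiction i∈R
          ([ (λ i≡x → x∉R ∘ subst (_∈ R) i≡x) , (λ i≡y → y∉R ∘ subst (_∈ R) i≡y) ] (∈⁅⁆∪⁅⁆⁻ (R⊆ i∈R)))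

  ρ⁅⁆∪⁅⁆≤1 : ∀ {x y} → x ≢ y → DependentRows (row G (⁅ x ⁆ ∪ ⁅ y ⁆) x) (row G (⁅ x ⁆ ∪ ⁅ y ⁆) y)
            → ρ G (⁅ x ⁆ ∪ ⁅ y ⁆) ≤ 1
  ρ⁅⁆∪⁅⁆≤1 {x} {y} x≢y dep = ρ-≤ {⁅ x ⁆ ∪ ⁅ y ⁆} bound
    where
    bound : ∀ S → S ⊆ ⁅ x ⁆ ∪ ⁅ y ⁆ → Independent (⁅ x ⁆ ∪ ⁅ y ⁆) S → ∣ S ∣ ≤ 1
    bound S S⊆ ind with x ∈? S | y ∈? S
    ... | no x∉S  | _       = ∣S∣≤1 (⊆⁅⁆∪⁅⁆-∉ˡ S⊆ x∉S)
    ... | yes _   | no y∉S  = ∣S∣≤1 (⊆⁅⁆∪⁅⁆-∉ʳ S⊆ y∉S)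
    ... | yes x∈S | yes y∈S = contradiction
      (independent-⁅⁆∪⁅⁆⁺ {X = ⁅ x ⁆ ∪ ⁅ y ⁆} x≢y (Independent-⊆ {⁅ x ⁆ ∪ ⁅ y ⁆} (⁅⁆∪⁅⁆⊆ x∈S y∈S) ind))
      (dependent⇒¬independent dep)

  2≤ρ⁅⁆∪⁅⁆ : ∀ {x y} → x ≢ y → IndependentRows (row G (⁅ x ⁆ ∪ ⁅ y ⁆) x) (row G (⁅ x ⁆ ∪ ⁅ y ⁆) y)
            → 2 ≤ ρ G (⁅ x ⁆ ∪ ⁅ y ⁆)
  2≤ρ⁅⁆∪⁅⁆ {x} {y} x≢y rows =
    ≤-trans (2≤∣⁅x⁆∪⁅y⁆∣ x≢y) (≤-ρ (λ i∈ → i∈) (independent-⁅⁆∪⁅⁆⁻ {X = ⁅ x ⁆ ∪ ⁅ y ⁆} x≢y rows))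

module Neighbourhoods {n : ℕ} (G : Graph n) where

  Isolated : Fin n → Set
  Isolated x = ∀ z → adj G x z ≡ false

  HasNeighbour : Fin n → Set
  HasNeighbour x = ∃ (Adj G x)

  PendantAt : Fin n → Fin n → Set
  PendantAt x y = ∀ t → t ≢ x → t ≢ y → adj G x t ≡ false

  SameNeighbours : Fin n → Fin n → Set
  SameNeighbours x y = ∀ t → t ≢ x → t ≢ y → adj G x t ≡ adj G y t

  Dependent : Fin n → Fin n → Set
  Dependent x y = PendantAt x y ⊎ PendantAt y x ⊎ SameNeighbours x y

  Similar : Fin n → Fin n → Set
  Similar x y = (Isolated x × Isolated y) ⊎ (HasNeighbour x × HasNeighbour y × Dependent x y)

  hasNeighbour? : ∀ x → Dec (HasNeighbour x)
  hasNeighbour? x = any? (λ z → adj G x z ≟ᵇ true)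

  isolated? : ∀ x → Dec (Isolated x)
  isolated? x = all? (λ z → adj G x z ≟ᵇ false)

  pendantAt? : ∀ x y → Dec (PendantAt x y)
  pendantAt? x y = all? (λ t → ¬? (t ≟ x) →-dec ¬? (t ≟ y) →-dec adj G x t ≟ᵇ false)

  sameNeighbours? : ∀ x y → Dec (SameNeighbours x y)
  sameNeighbours? x y = all? (λ t → ¬? (t ≟ x) →-dec ¬? (t ≟ y) →-dec adj G x t ≟ᵇ adj G y t)

  dependent? : ∀ x y → Dec (Dependent x y)
  dependent? x y = pendantAt? x y ⊎-dec pendantAt? y x ⊎-dec sameNeighbours? x y

  similar? : ∀ x y → Dec (Similar x y)
  similar? x y =
    (isolated? x ×-dec isolated? y) ⊎-dec (hasNeighbour? x ×-dec hasNeighbour? y ×-dec dependent? x y)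

  isolated-or-hasNeighbour : ∀ x → Isolated x ⊎ HasNeighbour x
  isolated-or-hasNeighbour x with hasNeighbour? x
  ... | yes nx  = inj₂ nx
  ... | no ¬nx = inj₁ λ z → ¬-not (λ e → ¬nx (z , e))

  isolated⇒¬hasNeighbour : ∀ {x} → Isolated x → ¬ HasNeighbour x
  isolated⇒¬hasNeighbour iso (z , e) = contradiction (trans (≡.sym e) (iso z)) λ ()

  Adj⇒≢ : ∀ {x y} → Adj G x y → x ≢ y
  Adj⇒≢ {x} e refl = contradiction (trans (≡.sym e) (irrefl G x)) λ ()

  Adj-sym : ∀ {x y} → Adj G x y → Adj G y x
  Adj-sym {x} {y} e = trans (sym G y x) e

  pendant-Adj : ∀ {x y t} → PendantAt x y → Adj G x t → t ≡ y
  pendant-Adj {x} {y} {t} p e with t ≟ y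
  ... | yes t≡y = t≡y
  ... | no t≢y  = contradiction (trans (≡.sym e) (p t (≢-sym (Adj⇒≢ e)) t≢y)) λ ()

  pendant⇒Adj : ∀ {x y} → HasNeighbour x → PendantAt x y → Adj G x y
  pendant⇒Adj (z , e) p = subst (Adj G _) (pendant-Adj p e) e

  pendant-unique : ∀ {x y z} → HasNeighbour x → PendantAt x y → PendantAt x z → y ≡ z
  pendant-unique nx p q = pendant-Adj q (pendant⇒Adj nx p)

  pendant-of-pendant : ∀ {x y z} → HasNeighbour x → PendantAt x y → PendantAt y z → x ≡ z
  pendant-of-pendant nx p q = pendant-Adj q (Adj-sym (pendant⇒Adj nx p))

  sameNeighbours-sym : ∀ {x y} → SameNeighbours x y → SameNeighbours y x
  sameNeighbours-sym s t t≢y t≢x = ≡.sym (s t t≢x t≢y)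

  sameNeighbours-trans : ∀ {x y z} → x ≢ y → y ≢ z → x ≢ z
                       → SameNeighbours x y → SameNeighbours y z → SameNeighbours x z
  sameNeighbours-trans {x} {y} {z} x≢y y≢z x≢z s₁ s₂ t t≢x t≢z with t ≟ y
  ... | yes refl = begin
    adj G x t ≡⟨ sym G x t ⟩
    adj G t x ≡⟨ s₂ x x≢y x≢z ⟩
    adj G z x ≡⟨ sym G z x ⟩
    adj G x z ≡⟨ s₁ z (≢-sym x≢z) (≢-sym y≢z) ⟩
    adj G t z ≡⟨ sym G t z ⟩
    adj G z t ∎
    where open ≡.≡-Reasoning
  ... | no t≢y = trans (s₁ t t≢x t≢y) (s₂ t t≢y t≢z)

  sameNeighbours-pendant : ∀ {x y z} → x ≢ y → x ≢ z → SameNeighbours x y → PendantAt y z → PendantAt x z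
  sameNeighbours-pendant {x} {y} x≢y x≢z s p t t≢x t≢z with t ≟ y
  ... | yes refl = trans (sym G x t) (p x x≢y x≢z)
  ... | no t≢y   = trans (s t t≢x t≢y) (p t t≢y t≢z)

  pendants-sameNeighbours : ∀ {x y z} → HasNeighbour x → HasNeighbour z
                          → PendantAt x y → PendantAt z y → SameNeighbours x z
  pendants-sameNeighbours {y = y} nx nz p q t t≢x t≢z with t ≟ y
  ... | yes refl = trans (pendant⇒Adj nx p) (≡.sym (pendant⇒Adj nz q))
  ... | no t≢y   = trans (p t t≢x t≢y) (≡.sym (q t t≢z t≢y))

  sameNeighbours-pendant⇒≡ : ∀ {x y z} → z ≢ x → HasNeighbour z → SameNeighbours x y → PendantAt z y → x ≡ y
  sameNeighbours-pendant⇒≡ {y = y} {z} z≢x nz s q =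
    pendant-Adj q (Adj-sym (trans (s z z≢x (Adj⇒≢ zy)) (Adj-sym zy)))
    where
    zy : Adj G z y
    zy = pendant⇒Adj nz q

  dependent-refl : ∀ x → Dependent x x
  dependent-refl x = inj₂ (inj₂ λ _ _ _ → refl)

  dependent-sym : ∀ {x y} → Dependent x y → Dependent y x
  dependent-sym (inj₁ p)        = inj₂ (inj₁ p)
  dependent-sym (inj₂ (inj₁ p)) = inj₁ p
  dependent-sym (inj₂ (inj₂ s)) = inj₂ (inj₂ (sameNeighbours-sym s))

  dependent-trans : ∀ {x y z} → HasNeighbour x → HasNeighbour y → HasNeighbour z → x ≢ y → y ≢ z → x ≢ z
                  → Dependent x y → Dependent y z → Dependent x z
  dependent-trans {x} {y} {z} nx ny nz x≢y y≢z x≢z = combine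
    where
    combine : Dependent x y → Dependent y z → Dependent x z
    combine (inj₁ pxy) (inj₁ pyz) = contradiction (pendant-of-pendant nx pxy pyz) x≢z
    combine (inj₁ pxy) (inj₂ (inj₁ pzy)) = inj₂ (inj₂ (pendants-sameNeighbours nx nz pxy pzy))
    combine (inj₁ pxy) (inj₂ (inj₂ syz)) =
      contradiction (sameNeighbours-pendant⇒≡ x≢z nx (sameNeighbours-sym syz) pxy) (≢-sym y≢z)
    combine (inj₂ (inj₁ pyx)) (inj₁ pyz) = contradiction (pendant-unique ny pyx pyz) x≢z
    combine (inj₂ (inj₁ pyx)) (inj₂ (inj₁ pzy)) = contradiction (pendant-of-pendant nz pzy pyx) (≢-sym x≢z)
    combine (inj₂ (inj₁ pyx)) (inj₂ (inj₂ syz)) =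
      inj₂ (inj₁ (sameNeighbours-pendant (≢-sym y≢z) (≢-sym x≢z) (sameNeighbours-sym syz) pyx))
    combine (inj₂ (inj₂ sxy)) (inj₁ pyz) = inj₁ (sameNeighbours-pendant x≢y x≢z sxy pyz)
    combine (inj₂ (inj₂ sxy)) (inj₂ (inj₁ pzy)) = contradiction (sameNeighbours-pendant⇒≡ (≢-sym x≢z) nz sxy pzy) x≢y
    combine (inj₂ (inj₂ sxy)) (inj₂ (inj₂ syz)) = inj₂ (inj₂ (sameNeighbours-trans x≢y y≢z x≢z sxy syz))

  similar-refl : ∀ x → Similar x x
  similar-refl x with isolated-or-hasNeighbour x
  ... | inj₁ ix = inj₁ (ix , ix)
  ... | inj₂ nx = inj₂ (nx , nx , dependent-refl x)

  similar-sym : ∀ {x y} → Similar x y → Similar y x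
  similar-sym (inj₁ (ix , iy))     = inj₁ (iy , ix)
  similar-sym (inj₂ (nx , ny , d)) = inj₂ (ny , nx , dependent-sym d)

  similar-trans : ∀ {x y z} → Similar x y → Similar y z → Similar x z
  similar-trans {x} {y} {z} s₁ s₂ with x ≟ y | y ≟ z | x ≟ z
  ... | yes refl | _        | _        = s₂
  ... | no _     | yes refl | _        = s₁
  ... | no _     | no _     | yes refl = similar-refl x
  ... | no x≢y   | no y≢z   | no x≢z   = combine s₁ s₂
    where
    combine : Similar x y → Similar y z → Similar x z
    combine (inj₁ (ix , _))      (inj₁ (_ , iz))        = inj₁ (ix , iz)
    combine (inj₁ (_ , iy))      (inj₂ (ny , _))        = contradiction ny (isolated⇒¬hasNeighbour iy)
    combine (inj₂ (_ , ny , _))  (inj₁ (iy , _))        = contradiction ny (isolated⇒¬hasNeighbour iy)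
    combine (inj₂ (nx , ny , d₁)) (inj₂ (_ , nz , d₂)) = inj₂ (nx , nz , dependent-trans nx ny nz x≢y y≢z x≢z d₁ d₂)

  module _ {x : Fin n} where

    member-isolated : ∀ {u} → Isolated x → Similar x u → Isolated u
    member-isolated ix (inj₁ (_ , iu))  = iu
    member-isolated ix (inj₂ (nx , _)) = contradiction nx (isolated⇒¬hasNeighbour ix)

    member-hasNeighbour : ∀ {u} → HasNeighbour x → Similar x u → HasNeighbour u
    member-hasNeighbour nx (inj₁ (ix , _))    = contradiction nx (isolated⇒¬hasNeighbour ix)
    member-hasNeighbour nx (inj₂ (_ , nu , _)) = nu

    members-dependent : ∀ {u v} → HasNeighbour x → Similar x u → Similar x v → Dependent u v
    members-dependent nx su sv with similar-trans (similar-sym su) sv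
    ... | inj₁ (iu , _)      = contradiction (member-hasNeighbour nx su) (isolated⇒¬hasNeighbour iu)
    ... | inj₂ (_ , _ , d) = d

    class-isolated : Isolated x → IsFalseTwinIndep G (Similar x)
    class-isolated ix u v su sv u≢v =
      (λ e → contradiction (trans (≡.sym e) (iu v)) λ ()) , u≢v , λ z _ _ → trans (iu z) (≡.sym (iv z))
      where
      iu : Isolated u
      iu = member-isolated ix su
      iv : Isolated v
      iv = member-isolated ix sv

    class-star : ∀ {u v} → HasNeighbour x → Similar x u → Similar x v → u ≢ v → PendantAt u v
               → IsAttachedStar G (Similar x)
    class-star {u} {v} nx su sv u≢v puv =
      v , sv , (λ w sw w≢v → Adj-sym (pendant⇒Adj (member-hasNeighbour nx sw) (leaf sw w≢v)))
        , (λ w w′ sw _ w≢v w′≢v e → w′≢v (pendant-Adj (leaf sw w≢v) e))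
        , (λ w t sw w≢v ¬st e → ¬st (subst (Similar x) (≡.sym (pendant-Adj (leaf sw w≢v) e)) sv))
      where
      leaf : ∀ {w} → Similar x w → w ≢ v → PendantAt w v
      leaf {w} sw w≢v with w ≟ u
      ... | yes refl = puv
      ... | no w≢u with members-dependent nx su sw
      ... | inj₁ puw        = contradiction (pendant-unique (member-hasNeighbour nx su) puv puw) (≢-sym w≢v)
      ... | inj₂ (inj₁ pwu) = contradiction (pendant-of-pendant (member-hasNeighbour nx sw) pwu puv) w≢v
      ... | inj₂ (inj₂ suw) = sameNeighbours-pendant w≢u w≢v (sameNeighbours-sym suw) puv

    class-twins : HasNeighbour x → (∀ {u v} → Similar x u → Similar x v → u ≢ v → ¬ PendantAt u v)
                → IsTrueTwinClique G (Similar x) ⊎ IsFalseTwinIndep G (Similar x)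
    class-twins nx noPendant =
      cases (any? λ p → any? λ q → similar? x p ×-dec similar? x q ×-dec ¬? (p ≟ q) ×-dec adj G p q ≟ᵇ true)
      where
      twins : ∀ {u v} → Similar x u → Similar x v → u ≢ v → SameNeighbours u v
      twins su sv u≢v with members-dependent nx su sv
      ... | inj₁ p        = contradiction p (noPendant su sv u≢v)
      ... | inj₂ (inj₁ p) = contradiction p (noPendant sv su (≢-sym u≢v))
      ... | inj₂ (inj₂ s) = s

      adj-row-constant : ∀ {u v w} → Similar x u → Similar x v → Similar x w → v ≢ u → w ≢ u
                       → adj G u v ≡ adj G u w
      adj-row-constant {u} {v} {w} su sv sw v≢u w≢u with v ≟ w
      ... | yes refl = refl
      ... | no v≢w   = trans (sym G u v) (trans (twins sv sw v≢w u (≢-sym v≢u) (≢-sym w≢u)) (sym G w u))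

      adj-constant : ∀ {u v p q} → Similar x u → Similar x v → Similar x p → Similar x q → u ≢ v → p ≢ q
                   → adj G u v ≡ adj G p q
      adj-constant {u} {v} {p} {q} su sv sp sq u≢v p≢q with p ≟ u
      ... | yes refl = adj-row-constant sp sv sq (≢-sym u≢v) (≢-sym p≢q)
      ... | no p≢u   = begin
        adj G u v ≡⟨ adj-row-constant su sv sp (≢-sym u≢v) p≢u ⟩
        adj G u p ≡⟨ sym G u p ⟩
        adj G p u ≡⟨ adj-row-constant sp su sq (≢-sym p≢u) (≢-sym p≢q) ⟩
        adj G p q ∎
        where open ≡.≡-Reasoning

      cases : Dec (∃ λ p → ∃ λ q → Similar x p × Similar x q × p ≢ q × Adj G p q)
            → IsTrueTwinClique G (Similar x) ⊎ IsFalseTwinIndep G (Similar x)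
      cases (yes (p , q , sp , sq , p≢q , e)) =
        inj₁ λ u v su sv u≢v → trans (adj-constant su sv sp sq u≢v p≢q) e , u≢v , twins su sv u≢v
      cases (no ¬adjacent) =
        inj₂ λ u v su sv u≢v → (λ e → ¬adjacent (u , v , su , sv , u≢v , e)) , u≢v , twins su sv u≢v

  classify : ∀ x → IsAttachedStar G (Similar x) ⊎ IsTrueTwinClique G (Similar x) ⊎ IsFalseTwinIndep G (Similar x)
  classify x with isolated-or-hasNeighbour x
  ... | inj₁ ix = inj₂ (inj₂ (class-isolated ix))
  ... | inj₂ nx with any? (λ u → any? λ v → similar? x u ×-dec similar? x v ×-dec ¬? (u ≟ v) ×-dec pendantAt? u v)
  ... | yes (u , v , su , sv , u≢v , puv) = inj₁ (class-star nx su sv u≢v puv)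
  ... | no ¬pendant = inj₂ (class-twins nx λ su sv u≢v puv → ¬pendant (_ , _ , su , sv , u≢v , puv))

module CutRank {n : ℕ} (G : Graph n) where

  open Rank G
  open Neighbourhoods G

  module _ {x y : Fin n} where

    off-or-in : ∀ t → t ∈ ⁅ x ⁆ ∪ ⁅ y ⁆ ⊎ (t ≢ x × t ≢ y)
    off-or-in t with t ∈? ⁅ x ⁆ ∪ ⁅ y ⁆
    ... | yes t∈ = inj₁ t∈
    ... | no t∉  = inj₂ ((λ t≡x → t∉ (subst (_∈ _) (≡.sym t≡x) x∈⁅x⁆∪⁅y⁆))
                       , (λ t≡y → t∉ (subst (_∈ _) (≡.sym t≡y) y∈⁅x⁆∪⁅y⁆)))

    row-in : ∀ {i t} → t ∈ ⁅ x ⁆ ∪ ⁅ y ⁆ → row G (⁅ x ⁆ ∪ ⁅ y ⁆) i t ≡ false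
    row-in {i} t∈ = trans (cong (λ b → adj G i _ ∧ not b) ([]=⇒lookup t∈)) (∧-zeroʳ _)

    row-off : ∀ {i t} → t ≢ x → t ≢ y → row G (⁅ x ⁆ ∪ ⁅ y ⁆) i t ≡ adj G i t
    row-off {i} t≢x t≢y =
      trans (cong (λ b → adj G i _ ∧ not b) (∉⇒lookup≡false ([ t≢x , t≢y ] ∘ ∈⁅⁆∪⁅⁆⁻))) (∧-identityʳ _)

    row-zero : ∀ {i} → (∀ t → t ≢ x → t ≢ y → adj G i t ≡ false) → ∀ t → row G (⁅ x ⁆ ∪ ⁅ y ⁆) i t ≡ false
    row-zero off t = [ row-in , (λ (t≢x , t≢y) → trans (row-off t≢x t≢y) (off t t≢x t≢y)) ]′ (off-or-in t)

    rows-equal : ∀ {i j} → (∀ t → t ≢ x → t ≢ y → adj G i t ≡ adj G j t)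
               → ∀ t → row G (⁅ x ⁆ ∪ ⁅ y ⁆) i t ≡ row G (⁅ x ⁆ ∪ ⁅ y ⁆) j t
    rows-equal off t =
      [ (λ t∈ → trans (row-in t∈) (≡.sym (row-in t∈)))
      , (λ (t≢x , t≢y) → trans (row-off t≢x t≢y) (trans (off t t≢x t≢y) (≡.sym (row-off t≢x t≢y))))
      ]′ (off-or-in t)

  dependent⇒dependentRows : ∀ {x y} → Dependent x y
                          → DependentRows (row G (⁅ x ⁆ ∪ ⁅ y ⁆) x) (row G (⁅ x ⁆ ∪ ⁅ y ⁆) y)
  dependent⇒dependentRows (inj₁ pxy)        = inj₁ (row-zero pxy)
  dependent⇒dependentRows (inj₂ (inj₁ pyx)) = inj₂ (inj₁ (row-zero λ t t≢x t≢y → pyx t t≢y t≢x))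
  dependent⇒dependentRows (inj₂ (inj₂ sxy)) = inj₂ (inj₂ (rows-equal sxy))

  ¬dependent⇒independentRows : ∀ {x y} → ¬ Dependent x y
                             → IndependentRows (row G (⁅ x ⁆ ∪ ⁅ y ⁆) x) (row G (⁅ x ⁆ ∪ ⁅ y ⁆) y)
  ¬dependent⇒independentRows {x} {y} ¬dep =
      nonZero (¬∀-off⇒∃ (λ t → adj G x t ≟ᵇ false) (¬dep ∘ inj₁))
    , nonZero (¬∀-off⇒∃ (λ t → adj G y t ≟ᵇ false) λ p → ¬dep (inj₂ (inj₁ λ t t≢y t≢x → p t t≢x t≢y)))
    , nonZeroSum (¬∀-off⇒∃ (λ t → adj G x t ≟ᵇ adj G y t) (¬dep ∘ inj₂ ∘ inj₂))
    where
    nonZero : ∀ {i} → (∃ λ t → t ≢ x × t ≢ y × adj G i t ≢ false) → NonZero (row G (⁅ x ⁆ ∪ ⁅ y ⁆) i)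
    nonZero (t , t≢x , t≢y , ne) = t , trans (row-off t≢x t≢y) (¬-not ne)
    nonZeroSum : (∃ λ t → t ≢ x × t ≢ y × adj G x t ≢ adj G y t)
               → NonZero (λ t → row G (⁅ x ⁆ ∪ ⁅ y ⁆) x t xor row G (⁅ x ⁆ ∪ ⁅ y ⁆) y t)
    nonZeroSum (t , t≢x , t≢y , ne) = t , (begin
      row G (⁅ x ⁆ ∪ ⁅ y ⁆) x t xor row G (⁅ x ⁆ ∪ ⁅ y ⁆) y t ≡⟨ ≡.cong₂ _xor_ (row-off t≢x t≢y) (row-off t≢x t≢y) ⟩
      adj G x t xor adj G y t                                 ≡⟨ cong (_xor adj G y t) (¬-not ne) ⟩
      not (adj G y t) xor adj G y t                           ≡⟨ xor-inverseˡ (adj G y t) ⟩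
      true                                                    ∎)
      where open ≡.≡-Reasoning

  isolated⇒row≡false : ∀ {i} → Isolated i → ∀ X t → row G X i t ≡ false
  isolated⇒row≡false iso X t = cong (_∧ not (lookup X t)) (iso t)

  ρ⁅⁆-isolated : ∀ {x} → Isolated x → ρ G ⁅ x ⁆ ≡ 0
  ρ⁅⁆-isolated {x} ix = ρ≡0 λ i∈ → isolated⇒row≡false (subst Isolated (≡.sym (x∈⁅y⁆⇒x≡y x i∈)) ix) ⁅ x ⁆

  ρ⁅⁆-hasNeighbour : ∀ {x} → HasNeighbour x → ρ G ⁅ x ⁆ ≡ 1
  ρ⁅⁆-hasNeighbour {x} (z , xz) =
    ≤-antisym (subst (ρ G ⁅ x ⁆ ≤_) (∣⁅x⁆∣≡1 x) (ρ≤∣X∣ ⁅ x ⁆)) (nonZero⇒1≤ρ (x∈⁅x⁆ x) (z , row≡true))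
    where
    row≡true : row G ⁅ x ⁆ x z ≡ true
    row≡true = ≡.cong₂ (λ a b → a ∧ not b) xz (∉⇒lookup≡false (x≢y⇒x∉⁅y⁆ (≢-sym (Adj⇒≢ xz))))

  ρ⁅⁆∪⁅⁆-isolated : ∀ {x y} → Isolated x → Isolated y → ρ G (⁅ x ⁆ ∪ ⁅ y ⁆) ≡ 0
  ρ⁅⁆∪⁅⁆-isolated {x} {y} ix iy = ρ≡0 λ i∈ → isolated⇒row≡false (isolated-at (∈⁅⁆∪⁅⁆⁻ i∈)) (⁅ x ⁆ ∪ ⁅ y ⁆)
    where
    isolated-at : ∀ {i} → i ≡ x ⊎ i ≡ y → Isolated i
    isolated-at (inj₁ refl) = ix
    isolated-at (inj₂ refl) = iy

  ρ⁅⁆∪⁅⁆-dependent : ∀ {x y} → x ≢ y → Dependent x y → ρ G (⁅ x ⁆ ∪ ⁅ y ⁆) ≤ 1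
  ρ⁅⁆∪⁅⁆-dependent x≢y = ρ⁅⁆∪⁅⁆≤1 x≢y ∘ dependent⇒dependentRows

  ρ⁅⁆∪⁅⁆-¬dependent : ∀ {x y} → x ≢ y → ¬ Dependent x y → 2 ≤ ρ G (⁅ x ⁆ ∪ ⁅ y ⁆)
  ρ⁅⁆∪⁅⁆-¬dependent x≢y = 2≤ρ⁅⁆∪⁅⁆ x≢y ∘ ¬dependent⇒independentRows

  ≡G⇒similar : ∀ {x y} → _≡G_ G x y → Similar x y
  ≡G⇒similar {x} {y} (ρx≡ρy , ρxy≤ρx) with x ≟ y
  ... | yes refl = similar-refl x
  ... | no x≢y with isolated-or-hasNeighbour x | isolated-or-hasNeighbour y
  ... | inj₁ ix | inj₁ iy = inj₁ (ix , iy)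
  ... | inj₁ ix | inj₂ ny = contradiction (trans (≡.sym (ρ⁅⁆-isolated ix)) (trans ρx≡ρy (ρ⁅⁆-hasNeighbour ny))) λ ()
  ... | inj₂ nx | inj₁ iy = contradiction (trans (≡.sym (ρ⁅⁆-hasNeighbour nx)) (trans ρx≡ρy (ρ⁅⁆-isolated iy))) λ ()
  ... | inj₂ nx | inj₂ ny with dependent? x y
  ... | yes dxy = inj₂ (nx , ny , dxy)
  ... | no ¬dxy = contradiction
    (≤-trans (ρ⁅⁆∪⁅⁆-¬dependent x≢y ¬dxy) (subst (ρ G (⁅ x ⁆ ∪ ⁅ y ⁆) ≤_) (ρ⁅⁆-hasNeighbour nx) ρxy≤ρx))
    λ { (s≤s ()) }

  similar⇒≡G : ∀ {x y} → Similar x y → _≡G_ G x y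
  similar⇒≡G {x} {y} sxy with x ≟ y
  ... | yes refl = refl , ≤-reflexive (cong (ρ G) (∪-idem ⁅ x ⁆))
  ... | no x≢y = distinct sxy
    where
    distinct : Similar x y → _≡G_ G x y
    distinct (inj₁ (ix , iy)) =
      trans (ρ⁅⁆-isolated ix) (≡.sym (ρ⁅⁆-isolated iy)) ,
      ≤-reflexive (trans (ρ⁅⁆∪⁅⁆-isolated ix iy) (≡.sym (ρ⁅⁆-isolated ix)))
    distinct (inj₂ (nx , ny , dxy)) =
      trans (ρ⁅⁆-hasNeighbour nx) (≡.sym (ρ⁅⁆-hasNeighbour ny)) ,
      subst (ρ G (⁅ x ⁆ ∪ ⁅ y ⁆) ≤_) (≡.sym (ρ⁅⁆-hasNeighbour nx)) (ρ⁅⁆∪⁅⁆-dependent x≢y dxy)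

module _ {n : ℕ} (G : Graph n) {P Q : Fin n → Set} (P⇒Q : ∀ {y} → P y → Q y) (Q⇒P : ∀ {y} → Q y → P y) where

  IsAttachedStar-resp : IsAttachedStar G P → IsAttachedStar G Q
  IsAttachedStar-resp (c , Pc , centre , leaves , attached) =
    c , P⇒Q Pc , (λ v → centre v ∘ Q⇒P) , (λ u v Qu Qv → leaves u v (Q⇒P Qu) (Q⇒P Qv))
      , (λ u w Qu u≢c ¬Qw → attached u w (Q⇒P Qu) u≢c (¬Qw ∘ P⇒Q))

  IsTrueTwinClique-resp : IsTrueTwinClique G P → IsTrueTwinClique G Q
  IsTrueTwinClique-resp clique u v Qu Qv = clique u v (Q⇒P Qu) (Q⇒P Qv)

  IsFalseTwinIndep-resp : IsFalseTwinIndep G P → IsFalseTwinIndep G Q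
  IsFalseTwinIndep-resp indep u v Qu Qv = indep u v (Q⇒P Qu) (Q⇒P Qv)

proposition3p1 : {n : ℕ} (G : Graph n)
    → IsEquivalence (_≡G_ G)
      × (∀ (x : Fin n) → IsAttachedStar G (λ y → _≡G_ G x y)
                       ⊎ IsTrueTwinClique G (λ y → _≡G_ G x y)
                       ⊎ IsFalseTwinIndep G (λ y → _≡G_ G x y))
proposition3p1 G = isEquivalence , λ x →
  Sum.map (IsAttachedStar-resp G similar⇒≡G (≡G⇒similar {x}))
          (Sum.map (IsTrueTwinClique-resp G similar⇒≡G (≡G⇒similar {x}))
                   (IsFalseTwinIndep-resp G similar⇒≡G (≡G⇒similar {x})))
          (classify x)
  where
  open Neighbourhoods G
  open CutRank G
  isEquivalence : IsEquivalence (_≡G_ G)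
  isEquivalence = record
    { refl  = λ {x} → similar⇒≡G (similar-refl x)
    ; sym   = λ {x} {y} → similar⇒≡G ∘ similar-sym ∘ ≡G⇒similar {x} {y}
    ; trans = λ {x} {y} {z} x≡y y≡z →
                similar⇒≡G (similar-trans (≡G⇒similar {x} {y} x≡y) (≡G⇒similar {y} {z} y≡z))
    }
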